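{- For every $n\ge1$ and every edge $\lambda\mu$ of $G_n$, the support jump $\Delta_\sigma(\lambda,\mu)=\sigma(\mu)-\sigma(\lambda)$ satisfies \[ \Delta_\sigma(\lambda,\mu)\in\{ -2,-1,0,1,2\}. \]
   Context: $G_n$ is the partition graph: its vertices are the partitions of $n$, and two distinct partitions $\lambda\neq\mu$ are adjacent when $\mu$ is obtained from $\lambda$ by moving one cell from one part (of size $x$, the part shrinking to $x-1$ and disappearing if $x=1$) to another part or to a new part of size $1$, followed by reordering the parts in weakly decreasing order. $\sigma(\lambda)$ denotes the number of distinct part sizes of $\lambda$. -}

module Defs where

open import Data.Nat using (ℕ; zero; suc; _<_; _≥_)
open import Data.Nat.Properties using (_≟_)
open import Data.List using (List; []; _∷_; length; deduplicate)
open import Data.Nat.ListAction using (sum)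
open import Data.List.Relation.Unary.All using (All)
open import Data.List.Relation.Unary.Linked using (Linked)
open import Data.List.Relation.Binary.Permutation.Propositional using (_↭_)
open import Data.Integer using (ℤ; +_; _-_)
open import Data.Product using (_×_; ∃; ∃₂)
open import Data.Sum using (_⊎_)
open import Relation.Binary.PropositionalEquality using (_≡_)
open import Relation.Nullary using (¬_)

IsPartition : ℕ → List ℕ → Set
IsPartition n λs = Linked _≥_ λs × All (0 <_) λs × sum λs ≡ n

-- Prepend a part, dropping it if it has size 0 (a part of size 1 that
-- loses its cell disappears).
_∷⁺_ : ℕ → List ℕ → List ℕ
zero  ∷⁺ xs = xs
suc k ∷⁺ xs = suc k ∷ xs

-- Move λs μs: μs arises from λs by moving one cell from a part of size
-- x (shrinking it to x-1, removed if 0) either to another part y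
-- (becoming y+1) or to a new part of size 1; the result is compared up to
-- reordering (μs is a permutation of the resulting multiset of parts).
Move : List ℕ → List ℕ → Set
Move λs μs =
  ∃₂ λ (x : ℕ) (rest : List ℕ) →
    (λs ↭ suc x ∷ rest) ×
    ( (∃₂ λ (y : ℕ) (rest' : List ℕ) →
         (rest ↭ y ∷ rest') × (μs ↭ (x ∷⁺ (suc y ∷ rest'))))
    ⊎ (μs ↭ (x ∷⁺ (1 ∷ rest))) )

Adjacent : ℕ → List ℕ → List ℕ → Set
Adjacent n λs μs =
  IsPartition n λs × IsPartition n μs × ¬ (λs ≡ μs) × Move λs μs

σ : List ℕ → ℕ
σ λs = length (deduplicate _≟_ λs)

Δσ : List ℕ → List ℕ → ℤ
Δσ λs μs = + σ μs - + σ λs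

-- σ is invariant under reordering, and adding one element to a list never decreases σ and
-- raises it by at most 1. A move touches at most two parts: both λ and μ consist of the
-- untouched parts plus at most two further parts, so σ(λ) and σ(μ) both lie in [c, c + 2],
-- where c is σ of the untouched parts.
module Submission where

open import Defs
open import Data.Nat using (ℕ; zero; suc; _+_; _≤_; _≥_; z≤n; s≤s; s≤s⁻¹)
open import Data.Nat.Properties using (_≟_; ≤-refl; ≤-trans; n≤1+n; +-monoˡ-≤; +-monoʳ-≤)
open import Data.List using (List; []; _∷_; [_]; _++_; length; deduplicate)
open import Data.List.Properties using (length-filter; filter-all)
open import Data.List.Membership.Propositional using (_∈_; _∉_)
open import Data.List.Membership.Propositional.Properties using (deduplicate-∈⇔; ∈-deduplicate⁻)
open import Data.List.Membership.Propositional.Properties.WithK using (unique∧set⇒bag)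
open import Data.List.Membership.DecPropositional _≟_ using (_∈?_)
open import Data.List.Relation.Unary.Any using (here; there)
open import Data.List.Relation.Unary.All using (All)
open import Data.List.Relation.Unary.All.Properties using (¬Any⇒All¬)
open import Data.List.Relation.Unary.Unique.DecPropositional.Properties _≟_ using (deduplicate-!)
open import Data.List.Relation.Binary.BagAndSetEquality using (_∼[_]_; set; bag-=⇒; ↭⇒∼bag; ∼bag⇒↭)
open import Data.List.Relation.Binary.Permutation.Propositional using (_↭_; ↭-trans; ↭-prep)
open import Data.List.Relation.Binary.Permutation.Propositional.Properties using (↭-length)
open import Data.Integer using (ℤ; +_; -_; _⊖_)
open import Data.Integer.Properties using (m-n≡m⊖n; [1+m]⊖[1+n]≡m⊖n)
open import Data.Product using (_×_; _,_; ∃)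
open import Data.Sum using (inj₁; inj₂)
open import Function.Base using (_∘_)
open import Function.Bundles using (mk⇔)
import Function.Properties.Equivalence as ⇔
open import Relation.Nullary using (¬_; ¬?; yes; no)
open import Relation.Binary.PropositionalEquality using (_≡_; refl; sym; cong; subst)

σ-resp-set : ∀ {xs ys} → xs ∼[ set ] ys → σ xs ≡ σ ys
σ-resp-set {xs} {ys} xs≈ys =
  ↭-length (∼bag⇒↭ (unique∧set⇒bag (deduplicate-! xs) (deduplicate-! ys) dedup≈))
  where
  dedup≈ : deduplicate _≟_ xs ∼[ set ] deduplicate _≟_ ys
  dedup≈ = ⇔.trans (⇔.sym (deduplicate-∈⇔ _≟_)) (⇔.trans xs≈ys (deduplicate-∈⇔ _≟_))

σ-resp-↭ : ∀ {xs ys} → xs ↭ ys → σ xs ≡ σ ys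
σ-resp-↭ = σ-resp-set ∘ bag-=⇒ ∘ ↭⇒∼bag

σ-∷-∈ : ∀ {a xs} → a ∈ xs → σ (a ∷ xs) ≡ σ xs
σ-∷-∈ a∈xs = σ-resp-set (mk⇔ (λ { (here refl) → a∈xs ; (there z∈xs) → z∈xs }) there)

σ-∷-∉ : ∀ {a xs} → a ∉ xs → σ (a ∷ xs) ≡ suc (σ xs)
σ-∷-∉ {a} {xs} a∉xs = cong (suc ∘ length) (filter-all (¬? ∘ (a ≟_)) a-fresh)
  where
  a-fresh : All (λ y → ¬ a ≡ y) (deduplicate _≟_ xs)
  a-fresh = ¬Any⇒All¬ (deduplicate _≟_ xs) (a∉xs ∘ ∈-deduplicate⁻ _≟_ xs)

σ-≤-∷ : ∀ a xs → σ xs ≤ σ (a ∷ xs)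
σ-≤-∷ a xs with a ∈? xs
... | yes a∈xs rewrite σ-∷-∈ a∈xs = ≤-refl
... | no  a∉xs rewrite σ-∷-∉ a∉xs = n≤1+n (σ xs)

σ-∷-≤ : ∀ a xs → σ (a ∷ xs) ≤ suc (σ xs)
σ-∷-≤ a xs = s≤s (length-filter (¬? ∘ (a ≟_)) (deduplicate _≟_ xs))

σ-≤-++ : ∀ xs ys → σ ys ≤ σ (xs ++ ys)
σ-≤-++ []       ys = ≤-refl
σ-≤-++ (x ∷ xs) ys = ≤-trans (σ-≤-++ xs ys) (σ-≤-∷ x (xs ++ ys))

σ-++-≤ : ∀ xs ys → σ (xs ++ ys) ≤ length xs + σ ys
σ-++-≤ []       ys = ≤-refl
σ-++-≤ (x ∷ xs) ys = ≤-trans (σ-∷-≤ x (xs ++ ys)) (s≤s (σ-++-≤ xs ys))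

Extends : ℕ → List ℕ → List ℕ → Set
Extends k core xs = ∃ λ extra → length extra ≤ k × xs ↭ extra ++ core

σ-Extends : ∀ {k core xs} → Extends k core xs → σ core ≤ σ xs × σ xs ≤ k + σ core
σ-Extends {k} {core} (extra , extra≤k , xs↭) rewrite σ-resp-↭ xs↭ =
  σ-≤-++ extra core , ≤-trans (σ-++-≤ extra core) (+-monoˡ-≤ (σ core) extra≤k)

σ-≤-2+σ : ∀ {core xs ys} → Extends 2 core xs → Extends 2 core ys → σ xs ≤ 2 + σ ys
σ-≤-2+σ xs-ext ys-ext =
  let _ , xs≤ = σ-Extends xs-ext
      core≤ , _ = σ-Extends ys-ext
  in ≤-trans xs≤ (+-monoʳ-≤ 2 core≤)

length-∷⁺ : ∀ x xs → length (x ∷⁺ xs) ≤ suc (length xs)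
length-∷⁺ zero    xs = n≤1+n (length xs)
length-∷⁺ (suc x) xs = ≤-refl

∷⁺-++ : ∀ x ys zs → x ∷⁺ (ys ++ zs) ≡ (x ∷⁺ ys) ++ zs
∷⁺-++ zero    ys zs = refl
∷⁺-++ (suc x) ys zs = refl

Move⇒common-core : ∀ {λs μs} → Move λs μs → ∃ λ core → Extends 2 core λs × Extends 2 core μs
Move⇒common-core (x , rest , λs↭ , inj₁ (y , rest' , rest↭ , μs↭)) =
  rest' , (suc x ∷ y ∷ [] , ≤-refl , ↭-trans λs↭ (↭-prep (suc x) rest↭))
        , (x ∷⁺ [ suc y ] , length-∷⁺ x [ suc y ] , subst (_ ↭_) (∷⁺-++ x [ suc y ] rest') μs↭)
Move⇒common-core (x , rest , λs↭ , inj₂ μs↭) =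
  rest , ([ suc x ] , s≤s z≤n , λs↭)
       , (x ∷⁺ [ 1 ] , length-∷⁺ x [ 1 ] , subst (_ ↭_) (∷⁺-++ x [ 1 ] rest) μs↭)

[-2⋯2] : List ℤ
[-2⋯2] = - + 2 ∷ - + 1 ∷ + 0 ∷ + 1 ∷ + 2 ∷ []

⊖-∈-[-2⋯2] : ∀ {p q} → p ≤ 2 + q → q ≤ 2 + p → q ⊖ p ∈ [-2⋯2]
⊖-∈-[-2⋯2] {zero}  {zero}  _ _ = there (there (here refl))
⊖-∈-[-2⋯2] {zero}  {1}     _ _ = there (there (there (here refl)))
⊖-∈-[-2⋯2] {zero}  {2}     _ _ = there (there (there (there (here refl))))
⊖-∈-[-2⋯2] {zero}  {suc (suc (suc _))} _ (s≤s (s≤s ()))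
⊖-∈-[-2⋯2] {1}     {zero}  _ _ = there (here refl)
⊖-∈-[-2⋯2] {2}     {zero}  _ _ = here refl
⊖-∈-[-2⋯2] {suc (suc (suc _))} {zero} (s≤s (s≤s ())) _
⊖-∈-[-2⋯2] {suc p} {suc q} p≤ q≤ rewrite [1+m]⊖[1+n]≡m⊖n q p =
  ⊖-∈-[-2⋯2] (s≤s⁻¹ p≤) (s≤s⁻¹ q≤)

corollary3p5 : (n : ℕ) → n ≥ 1 → (λs μs : List ℕ) → Adjacent n λs μs →
    Δσ λs μs ∈ (- + 2) ∷ (- + 1) ∷ + 0 ∷ + 1 ∷ + 2 ∷ []
corollary3p5 _ _ λs μs (_ , _ , _ , move) with Move⇒common-core move
... | _ , λs-ext , μs-ext =
  subst (_∈ [-2⋯2]) (sym (m-n≡m⊖n (σ μs) (σ λs)))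
        (⊖-∈-[-2⋯2] (σ-≤-2+σ λs-ext μs-ext) (σ-≤-2+σ μs-ext λs-ext))
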